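{- For all integers $k\ge 1$ and $n\ge 3$ with $(k,n)\neq(1,5)$, $\chi_i(C_{4k}\Box C_n)\le 6$.
   Context: For a graph $G$, an incidence is a pair $(v,e)$ with $v\in V(G)$, $e\in E(G)$ and $v$ incident with $e$. Two incidences $(v,e)$ and $(w,f)$ are adjacent if $v=w$, or $e=f$, or the edge $vw$ equals $e$ or $f$. An incidence $k$-coloring of $G$ is a map from the set of incidences of $G$ to a set of $k$ colors such that adjacent incidences receive distinct colors; $\chi_i(G)$ is the least $k$ for which such a coloring exists. $C_n$ is the cycle on $n$ vertices and $\Box$ denotes the Cartesian product of graphs. -}

module Defs where

open import Level using (0ℓ)
open import Data.Nat using (ℕ; zero; suc; _≤_)
open import Data.Fin using (Fin; toℕ)
open import Data.Product using (Σ; _×_; _,_; proj₁; proj₂; ∃-syntax)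
open import Data.Sum using (_⊎_)
open import Relation.Binary.PropositionalEquality using (_≡_; _≢_)
open import Relation.Nullary using (¬_)

record Graph : Set₁ where
  field
    V   : Set
    Adj : V → V → Set

open Graph public

-- An edge is an adjacent pair of vertices (considered as an unordered pair, see SameEdge).
Edge : Graph → Set
Edge G = Σ (V G × V G) λ p → Adj G (proj₁ p) (proj₂ p)

SameEdge : (G : Graph) → Edge G → Edge G → Set
SameEdge G ((v , w) , _) ((x , y) , _) = (v ≡ x × w ≡ y) ⊎ (v ≡ y × w ≡ x)

-- An incidence (v , e) with v incident to e = vw : represented as (v , edge vw).
-- Since e = vw contains v, the incidence is determined by v and the other end w.
Incidence : Graph → Set
Incidence G = Edge G

inc-vertex : (G : Graph) → Incidence G → V G
inc-vertex G ((v , w) , _) = v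

inc-edge : (G : Graph) → Incidence G → Edge G
inc-edge G i = i

IncAdj : (G : Graph) → Incidence G → Incidence G → Set
IncAdj G i j =
  (inc-vertex G i ≡ inc-vertex G j)
  ⊎ SameEdge G (inc-edge G i) (inc-edge G j)
  ⊎ (Σ (Adj G (inc-vertex G i) (inc-vertex G j)) λ a →
       SameEdge G ((inc-vertex G i , inc-vertex G j) , a) (inc-edge G i)
       ⊎ SameEdge G ((inc-vertex G i , inc-vertex G j) , a) (inc-edge G j))

SameInc : (G : Graph) → Incidence G → Incidence G → Set
SameInc G i j = (inc-vertex G i ≡ inc-vertex G j) × SameEdge G (inc-edge G i) (inc-edge G j)

IsIncidenceColoring : (G : Graph) (k : ℕ) → (Incidence G → Fin k) → Set
IsIncidenceColoring G k c =
  ∀ i j → ¬ SameInc G i j → IncAdj G i j → c i ≢ c j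

χi≤ : Graph → ℕ → Set
χi≤ G m = ∃[ k ] (k ≤ m × Σ (Incidence G → Fin k) (IsIncidenceColoring G k))

CycleStep : (n : ℕ) → Fin n → Fin n → Set
CycleStep n i j = (toℕ j ≡ suc (toℕ i)) ⊎ (suc (toℕ i) ≡ n × toℕ j ≡ 0)

C : ℕ → Graph
C n = record { V = Fin n ; Adj = λ i j → CycleStep n i j ⊎ CycleStep n j i }

_□_ : Graph → Graph → Graph
G □ H = record
  { V = V G × V H
  ; Adj = λ p q → (proj₁ p ≡ proj₁ q × Adj H (proj₂ p) (proj₂ q))
                ⊎ (Adj G (proj₁ p) (proj₁ q) × proj₂ p ≡ proj₂ q) }

-- Columns of C(4k) □ Cₙ are labelled by their index mod 4 and rows by types α, β, γ
-- read α β α β … (ending in γ when n is odd), so consecutive rows follow the pattern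
-- α→β, β→α, β→γ, γ→α. At a vertex in column x the four incidences get three of the
-- four cyclic colours x-1, x, x+1, x+2 and one of two spare colours; the colour of every
-- arc v→w is then either the cyclic colour missing at w or a spare colour unused at w.
module Submission where

open import Defs
open import Data.Bool using (Bool; true; false; not; if_then_else_)
open import Data.Empty using (⊥-elim)
open import Data.Fin using (Fin; zero; suc; toℕ; fromℕ; inject₁; _≟_)
open import Data.Fin.Properties using (toℕ<n; toℕ-injective; all?)
open import Data.Nat using (ℕ; zero; suc; _*_; _≤_; _<_; s≤s)
open import Data.Nat.Properties using (<⇒≢; *-suc; suc-injective; ≤-refl)
open import Data.Product using (_×_; _,_; proj₁; proj₂)
open import Data.Sum using (inj₁; inj₂)
open import Function.Definitions using (Injective)
open import Relation.Binary.PropositionalEquality using (_≡_; _≢_; refl; sym; trans; cong; subst)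
open import Relation.Nullary using (Dec; does; ¬_)
open import Relation.Nullary.Decidable using (from-yes; map′; _×-dec_; _→-dec_; ¬?; dec-true; dec-false)
import Data.Nat as ℕ

module _ (G : Graph) {k : ℕ} (c : Incidence G → Fin k) where

  DistinctAtVertices : Set
  DistinctAtVertices = ∀ {v w w′} (p : Adj G v w) (q : Adj G v w′) →
    c ((v , w) , p) ≡ c ((v , w′) , q) → w ≡ w′

  DistinctAlongArcs : Set
  DistinctAlongArcs = ∀ {v w u} (p : Adj G v w) (q : Adj G w u) →
    c ((v , w) , p) ≢ c ((w , u) , q)

  sameVertex⇒sameIncidence : DistinctAtVertices → ∀ i j →
    inc-vertex G i ≡ inc-vertex G j → c i ≡ c j → SameInc G i j
  sameVertex⇒sameIncidence atVertices ((v , w) , p) ((.v , w′) , q) refl ci≡cj =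
    refl , inj₁ (refl , atVertices p q ci≡cj)

  isIncidenceColoring : DistinctAtVertices → DistinctAlongArcs → IsIncidenceColoring G k c
  isIncidenceColoring atVertices alongArcs i@((_ , _) , p) j@((_ , _) , q) i≠j adj ci≡cj
    with adj
  ... | inj₁ v≡v′                                   = i≠j (sameVertex⇒sameIncidence atVertices i j v≡v′ ci≡cj)
  ... | inj₂ (inj₁ (inj₁ (v≡v′ , w≡w′)))            = i≠j (v≡v′ , inj₁ (v≡v′ , w≡w′))
  ... | inj₂ (inj₁ (inj₂ (refl , refl)))            = alongArcs p q ci≡cj
  ... | inj₂ (inj₂ (_ , inj₁ (inj₁ (_ , refl))))    = alongArcs p q ci≡cj
  ... | inj₂ (inj₂ (_ , inj₁ (inj₂ (_ , v′≡v))))    = i≠j (sameVertex⇒sameIncidence atVertices i j (sym v′≡v) ci≡cj)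
  ... | inj₂ (inj₂ (_ , inj₂ (inj₁ (v≡v′ , _))))    = i≠j (sameVertex⇒sameIncidence atVertices i j v≡v′ ci≡cj)
  ... | inj₂ (inj₂ (_ , inj₂ (inj₂ (refl , refl)))) = alongArcs q p (sym ci≡cj)

cycleStep-functional : ∀ {m} {i j j′ : Fin m} → CycleStep m i j → CycleStep m i j′ → j ≡ j′
cycleStep-functional (inj₁ j≡1+i) (inj₁ j′≡1+i) = toℕ-injective (trans j≡1+i (sym j′≡1+i))
cycleStep-functional (inj₂ (_ , j≡0)) (inj₂ (_ , j′≡0)) = toℕ-injective (trans j≡0 (sym j′≡0))
cycleStep-functional {j = j} (inj₁ j≡1+i) (inj₂ (1+i≡m , _)) = ⊥-elim (<⇒≢ (toℕ<n j) (trans j≡1+i 1+i≡m))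
cycleStep-functional {j′ = j′} (inj₂ (1+i≡m , _)) (inj₁ j′≡1+i) = ⊥-elim (<⇒≢ (toℕ<n j′) (trans j′≡1+i 1+i≡m))

cycleStep-injective : ∀ {m} {i i′ j : Fin m} → CycleStep m i j → CycleStep m i′ j → i ≡ i′
cycleStep-injective (inj₁ j≡1+i) (inj₁ j≡1+i′) = toℕ-injective (suc-injective (trans (sym j≡1+i) j≡1+i′))
cycleStep-injective (inj₂ (1+i≡m , _)) (inj₂ (1+i′≡m , _)) = toℕ-injective (suc-injective (trans 1+i≡m (sym 1+i′≡m)))
cycleStep-injective (inj₁ j≡1+i) (inj₂ (_ , j≡0)) with () ← trans (sym j≡1+i) j≡0
cycleStep-injective (inj₂ (_ , j≡0)) (inj₁ j≡1+i′) with () ← trans (sym j≡1+i′) j≡0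

Dir : Set
Dir = Fin 4

pattern east  = zero
pattern west  = suc zero
pattern north = suc (suc zero)
pattern south = suc (suc (suc zero))

module _ {m n : ℕ} where

  direction : ∀ {v w} → Adj (C m □ C n) v w → Dir
  direction (inj₁ (_ , inj₁ _)) = north
  direction (inj₁ (_ , inj₂ _)) = south
  direction (inj₂ (inj₁ _ , _)) = east
  direction (inj₂ (inj₂ _ , _)) = west

  neighbour-unique : ∀ {v w w′} (p : Adj (C m □ C n) v w) (q : Adj (C m □ C n) v w′) →
    direction p ≡ direction q → w ≡ w′
  neighbour-unique (inj₁ (refl , inj₁ s)) (inj₁ (refl , inj₁ s′)) _ = cong (_ ,_) (cycleStep-functional s s′)
  neighbour-unique (inj₁ (refl , inj₂ s)) (inj₁ (refl , inj₂ s′)) _ = cong (_ ,_) (cycleStep-injective s s′)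
  neighbour-unique (inj₂ (inj₁ s , refl)) (inj₂ (inj₁ s′ , refl)) _ = cong (_, _) (cycleStep-functional s s′)
  neighbour-unique (inj₂ (inj₂ s , refl)) (inj₂ (inj₂ s′ , refl)) _ = cong (_, _) (cycleStep-injective s s′)
  neighbour-unique (inj₁ (_ , inj₁ _)) (inj₁ (_ , inj₂ _)) ()
  neighbour-unique (inj₁ (_ , inj₁ _)) (inj₂ (inj₁ _ , _)) ()
  neighbour-unique (inj₁ (_ , inj₁ _)) (inj₂ (inj₂ _ , _)) ()
  neighbour-unique (inj₁ (_ , inj₂ _)) (inj₁ (_ , inj₁ _)) ()
  neighbour-unique (inj₁ (_ , inj₂ _)) (inj₂ (inj₁ _ , _)) ()
  neighbour-unique (inj₁ (_ , inj₂ _)) (inj₂ (inj₂ _ , _)) ()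
  neighbour-unique (inj₂ (inj₁ _ , _)) (inj₁ (_ , inj₁ _)) ()
  neighbour-unique (inj₂ (inj₁ _ , _)) (inj₁ (_ , inj₂ _)) ()
  neighbour-unique (inj₂ (inj₁ _ , _)) (inj₂ (inj₂ _ , _)) ()
  neighbour-unique (inj₂ (inj₂ _ , _)) (inj₁ (_ , inj₁ _)) ()
  neighbour-unique (inj₂ (inj₂ _ , _)) (inj₁ (_ , inj₂ _)) ()
  neighbour-unique (inj₂ (inj₂ _ , _)) (inj₂ (inj₁ _ , _)) ()

rotate : Fin 4 → Fin 4
rotate zero                   = suc zero
rotate (suc zero)             = suc (suc zero)
rotate (suc (suc zero))       = suc (suc (suc zero))
rotate (suc (suc (suc zero))) = zero

rotate⁻¹ : Fin 4 → Fin 4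
rotate⁻¹ zero                   = suc (suc (suc zero))
rotate⁻¹ (suc zero)             = zero
rotate⁻¹ (suc (suc zero))       = suc zero
rotate⁻¹ (suc (suc (suc zero))) = suc (suc zero)

rotate⁴ : ∀ x → rotate (rotate (rotate (rotate x))) ≡ x
rotate⁴ zero                   = refl
rotate⁴ (suc zero)             = refl
rotate⁴ (suc (suc zero))       = refl
rotate⁴ (suc (suc (suc zero))) = refl

residue₄ : ℕ → Fin 4
residue₄ zero    = zero
residue₄ (suc x) = rotate (residue₄ x)

residue₄-4*≡0 : ∀ k → residue₄ (4 * k) ≡ zero
residue₄-4*≡0 zero    = refl
residue₄-4*≡0 (suc k) = trans (cong residue₄ (*-suc 4 k)) (trans (rotate⁴ (residue₄ (4 * k))) (residue₄-4*≡0 k))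

residue₄-step : ∀ {k} {i i′ : Fin (4 * k)} → CycleStep (4 * k) i i′ →
  residue₄ (toℕ i′) ≡ rotate (residue₄ (toℕ i))
residue₄-step (inj₁ i′≡1+i) = cong residue₄ i′≡1+i
residue₄-step {k} (inj₂ (1+i≡4k , i′≡0)) =
  trans (cong residue₄ i′≡0) (trans (sym (residue₄-4*≡0 k)) (cong residue₄ (sym 1+i≡4k)))

data Row : Set where
  α β γ : Row

data Follows : Row → Row → Set where
  α→β : Follows α β
  β→α : Follows β α
  β→γ : Follows β γ
  γ→α : Follows γ α

even : ℕ → Bool
even zero    = true
even (suc x) = not (even x)

rowType : ℕ → ℕ → Row
rowType n y = if even y then (if does (suc y ℕ.≟ n) then γ else α) else β

follows-next : ∀ {n y} → suc y < n → Follows (rowType n y) (rowType n (suc y))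
follows-next {n} {y} 1+y<n with even y
... | true rewrite dec-false (suc y ℕ.≟ n) (<⇒≢ 1+y<n) = α→β
... | false with does (suc (suc y) ℕ.≟ n)
...   | true  = β→γ
...   | false = β→α

follows-wrap : ∀ {n y} → 3 ≤ n → suc y ≡ n → Follows (rowType n y) (rowType n 0)
follows-wrap {y = suc (suc y)} (s≤s (s≤s (s≤s _))) refl with even y
... | true rewrite dec-true (suc (suc (suc y)) ℕ.≟ suc (suc (suc y))) refl = γ→α
... | false = β→α

follows-step : ∀ {n} {j j′ : Fin n} → 3 ≤ n → CycleStep n j j′ →
  Follows (rowType n (toℕ j)) (rowType n (toℕ j′))
follows-step {n} {j} {j′} _ (inj₁ j′≡1+j) rewrite j′≡1+j = follows-next (subst (_< n) j′≡1+j (toℕ<n j′))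
follows-step 3≤n (inj₂ (1+j≡n , j′≡0)) rewrite j′≡0 = follows-wrap 3≤n 1+j≡n

cyclic : Fin 4 → Fin 6
cyclic x = suc (inject₁ x)

spare₀ spare₅ : Fin 6
spare₀ = zero
spare₅ = fromℕ 5

colour : Row → Fin 4 → Dir → Fin 6
colour α x east  = cyclic (rotate x)
colour α x west  = cyclic (rotate⁻¹ x)
colour α x north = spare₅
colour α x south = cyclic (rotate (rotate x))
colour β x east  = cyclic (rotate⁻¹ x)
colour β x west  = cyclic (rotate x)
colour β x north = spare₀
colour β x south = cyclic x
colour γ x east  = cyclic (rotate⁻¹ x)
colour γ x west  = cyclic (rotate x)
colour γ x north = cyclic x
colour γ x south = spare₅

all-rows? : ∀ {P : Row → Set} → (∀ t → Dec (P t)) → Dec (∀ t → P t)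
all-rows? P? = map′ (λ { (pα , pβ , pγ) α → pα ; (_ , pβ , _) β → pβ ; (_ , _ , pγ) γ → pγ })
                    (λ p → p α , p β , p γ)
                    (P? α ×-dec P? β ×-dec P? γ)

colour-injective : ∀ t x → Injective _≡_ _≡_ (colour t x)
colour-injective t x {d} {d′} = from-yes
  (all-rows? λ t → all? λ x → all? λ d → all? λ d′ → colour t x d ≟ colour t x d′ →-dec d ≟ d′)
  t x d d′

HorizontalArcsDistinct : Row → Set
HorizontalArcsDistinct t = ∀ x d → colour t x east ≢ colour t (rotate x) d
                                 × colour t (rotate x) west ≢ colour t x d

horizontal-arcs : ∀ t → HorizontalArcsDistinct t
horizontal-arcs = from-yes (all-rows? λ t → all? λ x → all? λ d →
  ¬? (colour t x east ≟ colour t (rotate x) d) ×-dec ¬? (colour t (rotate x) west ≟ colour t x d))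

VerticalArcsDistinct : Row → Row → Set
VerticalArcsDistinct t t′ = ∀ x d → colour t x north ≢ colour t′ x d
                                  × colour t′ x south ≢ colour t x d

vertical-arcs? : ∀ t t′ → Dec (VerticalArcsDistinct t t′)
vertical-arcs? t t′ = all? λ x → all? λ d →
  ¬? (colour t x north ≟ colour t′ x d) ×-dec ¬? (colour t′ x south ≟ colour t x d)

vertical-arcs : ∀ {t t′} → Follows t t′ → VerticalArcsDistinct t t′
vertical-arcs α→β = from-yes (vertical-arcs? α β)
vertical-arcs β→α = from-yes (vertical-arcs? β α)
vertical-arcs β→γ = from-yes (vertical-arcs? β γ)
vertical-arcs γ→α = from-yes (vertical-arcs? γ α)

module Torus (k n : ℕ) (3≤n : 3 ≤ n) where

  T : Graph
  T = C (4 * k) □ C n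

  row : Fin n → Row
  row j = rowType n (toℕ j)

  column : Fin (4 * k) → Fin 4
  column i = residue₄ (toℕ i)

  colouring : Incidence T → Fin 6
  colouring (((i , j) , _) , p) = colour (row j) (column i) (direction p)

  distinct-at-vertices : DistinctAtVertices T colouring
  distinct-at-vertices {i , j} p q same = neighbour-unique p q (colour-injective (row j) (column i) same)

  distinct-along-arcs : DistinctAlongArcs T colouring
  distinct-along-arcs (inj₁ (refl , inj₁ s)) q = proj₁ (vertical-arcs (follows-step 3≤n s) _ (direction q))
  distinct-along-arcs (inj₁ (refl , inj₂ s)) q = proj₂ (vertical-arcs (follows-step 3≤n s) _ (direction q))
  distinct-along-arcs {_ , j} (inj₂ (inj₁ s , refl)) q same =
    proj₁ (horizontal-arcs (row j) _ (direction q))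
          (trans same (cong (λ x → colour (row j) x (direction q)) (residue₄-step {k} s)))
  distinct-along-arcs {_ , j} (inj₂ (inj₂ s , refl)) q same =
    proj₂ (horizontal-arcs (row j) _ (direction q))
          (trans (cong (λ x → colour (row j) x west) (sym (residue₄-step {k} s))) same)

lemma2 : (k n : ℕ) → 1 ≤ k → 3 ≤ n → ¬ (k ≡ 1 × n ≡ 5) →
    χi≤ (C (4 * k) □ C n) 6
lemma2 k n _ 3≤n _ =
  6 , ≤-refl , colouring , isIncidenceColoring T colouring distinct-at-vertices distinct-along-arcs
  where open Torus k n 3≤n
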